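{- Let $w$ be an infinite word generated by a morphism $\phi$ with $\det A_\phi\ne\pm1$. If $w$ contains a cutting factor, then $w$ does not satisfy the WELLDOC property.
   Context: Alphabet $\Sigma=\{0,\dots,\sigma-1\}$. A morphism is nonerasing; $w$ is generated by $\phi$ if $\phi(a)=as$ with $s$ nonempty and $w=\lim_n\phi^n(a)$, so $w=\phi(w)$. $A_\phi$ is the $\sigma\times\sigma$ matrix with entry $|\phi(i)|_j$ in row $j$, column $i$. Define $f_w(0)=0$ and $f_w(i)=|\phi(w[0,i))|$ for $i>0$; the numbers $f_w(i)$ are called cutting points (so $w$ is the concatenation of blocks $w[f_w(i),f_w(i+1))=\phi(w_i)$). A factor $u$ of $w$ is cutting if there is an integer $k$ such that for every occurrence of $u$ in $w$ at a position $m$, the index $m+k$ is a cutting point. Parikh vector $V_u=(|u|_0,\dots,|u|_{\sigma-1})$; for a factor $u$ occurring at positions $a_0<a_1<\dots$, $X_u=\{V_{w[0,a_i)}\}$, $X_{u,m}$ its reduction mod $m$; WELLDOC means $X_{u,m}=(\mathbb{Z}/m\mathbb{Z})^\sigma$ for all $m\ge1$ and all factors $u$. -}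

module Defs where

open import Data.Nat using (ℕ; zero; suc; _+_; _%_)
open import Data.Integer as ℤ using (ℤ; +_)
open import Data.Fin using (Fin; zero; suc; toℕ; punchIn; _≟_)
open import Data.List using (List; []; _∷_; length; lookup; filter)
open import Data.Product using (Σ; ∃; _×_; _,_)
open import Data.Bool using (if_then_else_)
open import Relation.Nullary using (¬_; does)
open import Relation.Binary.PropositionalEquality using (_≡_)

Word∞ : ℕ → Set
Word∞ σ = ℕ → Fin σ

Morphism : ℕ → Set
Morphism σ = Fin σ → List (Fin σ)

Nonerasing : ∀ {σ} → Morphism σ → Set
Nonerasing φ = ∀ i → ¬ (φ i ≡ [])

-- Cutting-point function f_w: f_w(0) = 0, f_w(i+1) = f_w(i) + |φ(w_i)|,
-- i.e. f_w(i) = |φ(w[0,i))|.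
cutPt : ∀ {σ} → Morphism σ → Word∞ σ → ℕ → ℕ
cutPt φ w zero    = 0
cutPt φ w (suc i) = cutPt φ w i + length (φ (w i))

IsCuttingPoint : ∀ {σ} → Morphism σ → Word∞ σ → ℕ → Set
IsCuttingPoint φ w n = ∃ λ i → cutPt φ w i ≡ n

IsFixedPoint : ∀ {σ} → Morphism σ → Word∞ σ → Set
IsFixedPoint φ w = ∀ i (k : Fin (length (φ (w i)))) →
  w (cutPt φ w i + toℕ k) ≡ lookup (φ (w i)) k

-- w is generated by φ: φ nonerasing, φ(a) = a s with s nonempty,
-- and w = lim φ^n(a), characterised as the unique fixed point of φ
-- starting with a.
GeneratedBy : ∀ {σ} → Morphism σ → Word∞ σ → Set
GeneratedBy {σ} φ w = Nonerasing φ × Σ (Fin σ) λ a → Σ (List (Fin σ)) λ s →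
  (φ a ≡ a ∷ s) × ¬ (s ≡ []) × (w 0 ≡ a) × IsFixedPoint φ w

OccursAt : ∀ {σ} → Word∞ σ → List (Fin σ) → ℕ → Set
OccursAt w u m = ∀ (j : Fin (length u)) → w (m + toℕ j) ≡ lookup u j

IsFactor : ∀ {σ} → Word∞ σ → List (Fin σ) → Set
IsFactor w u = ¬ (u ≡ []) × ∃ λ m → OccursAt w u m

IsCutting : ∀ {σ} → Morphism σ → Word∞ σ → List (Fin σ) → Set
IsCutting φ w u = ∃ λ (k : ℤ) → ∀ m → OccursAt w u m →
  ∃ λ n → IsCuttingPoint φ w n × ((+ m) ℤ.+ k ≡ + n)

parikhPrefix : ∀ {σ} → Word∞ σ → ℕ → Fin σ → ℕ
parikhPrefix w zero    j = 0
parikhPrefix w (suc p) j =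
  parikhPrefix w p j + (if does (w p ≟ j) then 1 else 0)

-- X_{u,m} = (ℤ/mℤ)^σ, with m = suc n ≥ 1: every residue vector is
-- attained by the Parikh vector of a prefix preceding an occurrence of u.
XFull : ∀ {σ} → Word∞ σ → List (Fin σ) → ℕ → Set
XFull {σ} w u n = ∀ (t : Fin σ → ℕ) → ∃ λ p → OccursAt w u p ×
  (∀ j → parikhPrefix w p j % suc n ≡ t j % suc n)

WELLDOC : ∀ {σ} → Word∞ σ → Set
WELLDOC w = ∀ u → IsFactor w u → ∀ n → XFull w u n

Matrix : ℕ → Set
Matrix n = Fin n → Fin n → ℤ

incMatrix : ∀ {σ} → Morphism σ → Matrix σ
incMatrix φ j i = + length (filter (_≟ j) (φ i))

altSum : ∀ {n} → (Fin n → ℤ) → ℤ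
altSum {zero}  f = + 0
altSum {suc n} f = f zero ℤ.- altSum (λ i → f (suc i))

det : ∀ {n} → Matrix n → ℤ
det {zero}  M = + 1
det {suc n} M = altSum (λ i → M zero i ℤ.* det (λ r c → M (suc r) (punchIn i c)))

{-# OPTIONS --safe #-}

-- Let p be a prime dividing det A_φ. A cutting factor yields a factor v and a constant vector c
-- such that, for every occurrence of v at q, the Parikh vector of w[0,q) plus c is that of a prefix
-- ending at a cutting point f(i), i.e. A_φ times the Parikh vector of w[0,i), because w = φ(w).
-- WELLDOC for v modulo p therefore makes A_φ onto (ℤ/pℤ)^σ. But p cannot divide the determinant of
-- a matrix that is onto modulo p: column operations preserving both properties clear the top row
-- modulo p, and Laplace expansion along it reduces the claim to a minor.

module Submission where

open import Defs
open import Data.Nat as ℕ using (ℕ; _<_; _≤_)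
import Data.Nat.Properties as ℕP
open import Data.Integer as ℤ using (ℤ; +_; -_; _+_; _*_; _-_)
import Data.Integer.Properties as ℤP
open import Data.Integer.Tactic.RingSolver using (solve-∀)
open import Data.Integer.Divisibility.Signed using (_∣_; divides; _∣?_; ∣ᵤ⇒∣; ∣⇒∣ᵤ; ∣m∣n⇒∣m+n; ∣m∣n⇒∣m-n; ∣m+n∣m⇒∣n; ∣m⇒∣m*n; ∣n⇒∣m*n)
import Data.Nat.Divisibility as ℕDiv
import Data.Nat.DivMod as ℕDivMod
import Data.Integer.DivMod as ℤDivMod
open import Data.Nat.Primality using (Prime; euclidsLemma; ¬prime[0]; ¬prime[1]; prime[2])
open import Data.Nat.Primality.Factorisation using (factorise)
open import Data.Nat.ListAction using (product)
open import Data.List using (List; []; _∷_; length; lookup; filter; applyUpTo)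
open import Data.List.Properties using (length-applyUpTo; lookup-applyUpTo)
open import Data.List.Relation.Unary.All using (_∷_)
open import Data.Fin using (Fin; zero; suc; toℕ; fromℕ<; inject₁; punchIn; punchOut; _≟_)
import Data.Fin.Properties as FinP
open import Data.Vec.Functional using (updateAt) renaming (_∷_ to _∷ᵥ_)
open import Data.Vec.Functional.Properties using (updateAt-updates; updateAt-minimal)
open import Data.Bool using (true; false; if_then_else_)
open import Data.Product using (∃; ∃₂; _×_; _,_)
open import Data.Sum using (_⊎_; inj₁; inj₂)
open import Function using (_∘_)
open import Relation.Nullary using (¬_; does; yes; no; contradiction)
open import Relation.Binary.PropositionalEquality
open ≡-Reasoning

open import Algebra.Properties.Semiring.Sum ℤP.+-*-semiring
  using (sum; sum-cong-≗; sum-replicate-zero; ∑-distrib-+; *-distribˡ-sum)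

sum-zero : ∀ {n} {f : Fin n → ℤ} → (∀ i → f i ≡ + 0) → sum f ≡ + 0
sum-zero {n} f≡0 = trans (sum-cong-≗ f≡0) (sum-replicate-zero n)

indicator : ∀ {n} → Fin n → Fin n → ℕ
indicator x c = if does (x ≟ c) then 1 else 0

sum-indicator : ∀ {n} (f : Fin n → ℤ) x → sum (λ c → f c * + indicator x c) ≡ f x
sum-indicator f zero = begin
  f zero * + 1 + sum (λ c → f (suc c) * + 0) ≡⟨ cong₂ _+_ (ℤP.*-identityʳ (f zero)) (sum-zero (ℤP.*-zeroʳ ∘ f ∘ suc)) ⟩
  f zero + + 0                               ≡⟨ ℤP.+-identityʳ _ ⟩
  f zero                                     ∎
sum-indicator f (suc x) = begin
  f zero * + 0 + sum (λ c → f (suc c) * + indicator x c) ≡⟨ cong₂ _+_ (ℤP.*-zeroʳ (f zero)) (sum-indicator (f ∘ suc) x) ⟩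
  + 0 + f (suc x)                                        ≡⟨ ℤP.+-identityˡ _ ⟩
  f (suc x)                                              ∎

sum-adjacent-cong : ∀ {n} (j : Fin n) {f g : Fin (ℕ.suc n) → ℤ} →
  (∀ c → c ≢ inject₁ j → c ≢ suc j → f c ≡ g c) →
  f (inject₁ j) + f (suc j) ≡ g (inject₁ j) + g (suc j) → sum f ≡ sum g
sum-adjacent-cong zero {f} {g} f≡g pair = begin
  f zero + (f (suc zero) + rest f) ≡⟨ ℤP.+-assoc (f zero) (f (suc zero)) (rest f) ⟨
  f zero + f (suc zero) + rest f   ≡⟨ cong₂ _+_ pair (sum-cong-≗ λ c → f≡g (suc (suc c)) (λ ()) (λ ())) ⟩
  g zero + g (suc zero) + rest g   ≡⟨ ℤP.+-assoc (g zero) (g (suc zero)) (rest g) ⟩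
  g zero + (g (suc zero) + rest g) ∎
  where
  rest : (Fin _ → ℤ) → ℤ
  rest h = sum (h ∘ suc ∘ suc)
sum-adjacent-cong (suc j) f≡g pair =
  cong₂ _+_ (f≡g zero (λ ()) (λ ()))
            (sum-adjacent-cong j (λ c c≢j c≢j+1 →
               f≡g (suc c) (c≢j ∘ FinP.suc-injective) (c≢j+1 ∘ FinP.suc-injective)) pair)

altSum-cong : ∀ {n} {f g : Fin n → ℤ} → (∀ i → f i ≡ g i) → altSum f ≡ altSum g
altSum-cong {ℕ.zero}  f≡g = refl
altSum-cong {ℕ.suc n} f≡g = cong₂ _-_ (f≡g zero) (altSum-cong (f≡g ∘ suc))

altSum-zero : ∀ {n} {f : Fin n → ℤ} → (∀ i → f i ≡ + 0) → altSum f ≡ + 0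
altSum-zero {ℕ.zero}  f≡0 = refl
altSum-zero {ℕ.suc n} f≡0 = cong₂ _-_ (f≡0 zero) (altSum-zero (f≡0 ∘ suc))

altSum-linear : ∀ {n} a b (f g : Fin n → ℤ) →
  altSum (λ i → a * f i + b * g i) ≡ a * altSum f + b * altSum g
altSum-linear {ℕ.zero} a b f g = ring a b
  where
  ring : ∀ a b → + 0 ≡ a * + 0 + b * + 0
  ring = solve-∀
altSum-linear {ℕ.suc n} a b f g = begin
  a * f zero + b * g zero - altSum (λ i → a * f (suc i) + b * g (suc i))
    ≡⟨ cong (λ s → a * f zero + b * g zero - s) (altSum-linear a b (f ∘ suc) (g ∘ suc)) ⟩
  a * f zero + b * g zero - (a * altSum (f ∘ suc) + b * altSum (g ∘ suc))
    ≡⟨ ring a b (f zero) (g zero) _ _ ⟩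
  a * (f zero - altSum (f ∘ suc)) + b * (g zero - altSum (g ∘ suc)) ∎
  where
  ring : ∀ a b x y u v → a * x + b * y - (a * u + b * v) ≡ a * (x - u) + b * (y - v)
  ring = solve-∀

altSum-adjacent : ∀ {n} (j : Fin n) (f : Fin (ℕ.suc n) → ℤ) → f (inject₁ j) ≡ f (suc j) →
  (∀ i → i ≢ inject₁ j → i ≢ suc j → f i ≡ + 0) → altSum f ≡ + 0
altSum-adjacent zero f f₀≡f₁ others = begin
  f zero - (f (suc zero) - altSum (f ∘ suc ∘ suc))
    ≡⟨ cong₂ (λ x y → x - (f (suc zero) - y)) f₀≡f₁ (altSum-zero λ i → others (suc (suc i)) (λ ()) (λ ())) ⟩
  f (suc zero) - (f (suc zero) - + 0)
    ≡⟨ ring (f (suc zero)) ⟩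
  + 0 ∎
  where
  ring : ∀ x → x - (x - + 0) ≡ + 0
  ring = solve-∀
altSum-adjacent (suc j) f fⱼ≡fⱼ₊₁ others =
  cong₂ _-_ (others zero (λ ()) (λ ()))
            (altSum-adjacent j (f ∘ suc) fⱼ≡fⱼ₊₁ λ i i≢j i≢j+1 →
               others (suc i) (i≢j ∘ FinP.suc-injective) (i≢j+1 ∘ FinP.suc-injective))

minor : ∀ {n} → Fin (ℕ.suc n) → Matrix (ℕ.suc n) → Matrix n
minor i M r c = M (suc r) (punchIn i c)

det-cong : ∀ {n} {M N : Matrix n} → (∀ r c → M r c ≡ N r c) → det M ≡ det N
det-cong {ℕ.zero}  M≡N = refl
det-cong {ℕ.suc n} M≡N =
  altSum-cong λ i → cong₂ _*_ (M≡N zero i) (det-cong λ r c → M≡N (suc r) (punchIn i c))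

punchIn-inject₁-suc : ∀ {n} (j c : Fin n) → punchIn (inject₁ j) c ≡ punchIn (suc j) c ⊎
  (punchIn (inject₁ j) c ≡ suc j × punchIn (suc j) c ≡ inject₁ j)
punchIn-inject₁-suc zero    zero    = inj₂ (refl , refl)
punchIn-inject₁-suc zero    (suc c) = inj₁ refl
punchIn-inject₁-suc (suc j) zero    = inj₁ refl
punchIn-inject₁-suc (suc j) (suc c) with punchIn-inject₁-suc j c
... | inj₁ same            = inj₁ (cong suc same)
... | inj₂ (to-j+1 , to-j) = inj₂ (cong suc to-j+1 , cong suc to-j)

punchIn-adjacent : ∀ {n} (i : Fin (ℕ.suc (ℕ.suc n))) (j : Fin (ℕ.suc n)) → i ≢ inject₁ j → i ≢ suc j →
  ∃ λ j′ → punchIn i (inject₁ j′) ≡ inject₁ j × punchIn i (suc j′) ≡ suc j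
punchIn-adjacent zero          zero    i≢j _     = contradiction refl i≢j
punchIn-adjacent zero          (suc j) _   _     = j , refl , refl
punchIn-adjacent (suc zero)    zero    _   i≢j+1 = contradiction refl i≢j+1
punchIn-adjacent {ℕ.suc n} (suc (suc i)) zero _ _ = zero , refl , refl
punchIn-adjacent {ℕ.suc n} (suc i) (suc j) i≢j i≢j+1
  with punchIn-adjacent i j (i≢j ∘ cong suc) (i≢j+1 ∘ cong suc)
... | j′ , to-j , to-j+1 = suc j′ , cong suc to-j , cong suc to-j+1

-- The terms for i = j and i = j + 1 cancel because their minors coincide; every other minor
-- again has two equal adjacent columns.
det-adjacent : ∀ {n} (M : Matrix (ℕ.suc n)) (j : Fin n) → (∀ r → M r (inject₁ j) ≡ M r (suc j)) → det M ≡ + 0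
det-adjacent {ℕ.suc n} M j cols =
  altSum-adjacent j (λ i → M zero i * det (minor i M)) (cong₂ _*_ (cols zero) (det-cong equal-minors)) others
  where
  equal-minors : ∀ r c → minor (inject₁ j) M r c ≡ minor (suc j) M r c
  equal-minors r c with punchIn-inject₁-suc j c
  ... | inj₁ same = cong (M (suc r)) same
  ... | inj₂ (to-j+1 , to-j) =
    trans (cong (M (suc r)) to-j+1) (trans (sym (cols (suc r))) (cong (M (suc r)) (sym to-j)))
  others : ∀ i → i ≢ inject₁ j → i ≢ suc j → M zero i * det (minor i M) ≡ + 0
  others i i≢j i≢j+1 with punchIn-adjacent i j i≢j i≢j+1
  ... | j′ , to-j , to-j+1 = trans
    (cong (M zero i *_) (det-adjacent (minor i M) j′ λ r →
      trans (cong (M (suc r)) to-j) (trans (cols (suc r)) (cong (M (suc r)) (sym to-j+1)))))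
    (ℤP.*-zeroʳ (M zero i))

det-linear-column : ∀ {n} (d : Fin n) (a b : ℤ) {M N Q : Matrix n} →
  (∀ r c → c ≢ d → M r c ≡ N r c) → (∀ r c → c ≢ d → M r c ≡ Q r c) →
  (∀ r → M r d ≡ a * N r d + b * Q r d) → det M ≡ a * det N + b * det Q
det-linear-column {ℕ.suc n} d a b {M} {N} {Q} M≡N M≡Q column =
  trans (altSum-cong term) (altSum-linear a b (λ i → N zero i * det (minor i N)) (λ i → Q zero i * det (minor i Q)))
  where
  same-minor : ∀ {K} → (∀ r c → c ≢ d → M r c ≡ K r c) → det (minor d M) ≡ det (minor d K)
  same-minor M≡K = det-cong λ r c → M≡K (suc r) (punchIn d c) (FinP.punchInᵢ≢i d c)
  term : ∀ i → M zero i * det (minor i M) ≡ a * (N zero i * det (minor i N)) + b * (Q zero i * det (minor i Q))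
  term i with i ≟ d
  ... | yes refl = begin
    M zero i * det (minor i M)                                          ≡⟨ cong (_* det (minor i M)) (column zero) ⟩
    (a * N zero i + b * Q zero i) * det (minor i M)                     ≡⟨ ring a b (N zero i) (Q zero i) _ ⟩
    a * (N zero i * det (minor i M)) + b * (Q zero i * det (minor i M)) ≡⟨ cong₂ (λ x y → a * (N zero i * x) + b * (Q zero i * y)) (same-minor M≡N) (same-minor M≡Q) ⟩
    a * (N zero i * det (minor i N)) + b * (Q zero i * det (minor i Q)) ∎
    where
    ring : ∀ a b x y u → (a * x + b * y) * u ≡ a * (x * u) + b * (y * u)
    ring = solve-∀
  ... | no i≢d = begin
    M zero i * det (minor i M)                                          ≡⟨ cong (M zero i *_) minor-linear ⟩
    M zero i * (a * det (minor i N) + b * det (minor i Q))              ≡⟨ ring (M zero i) a b _ _ ⟩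
    a * (M zero i * det (minor i N)) + b * (M zero i * det (minor i Q)) ≡⟨ cong₂ (λ x y → a * (x * det (minor i N)) + b * (y * det (minor i Q))) (M≡N zero i i≢d) (M≡Q zero i i≢d) ⟩
    a * (N zero i * det (minor i N)) + b * (Q zero i * det (minor i Q)) ∎
    where
    ring : ∀ m a b u v → m * (a * u + b * v) ≡ a * (m * u) + b * (m * v)
    ring = solve-∀
    d′ : Fin n
    d′ = punchOut i≢d
    punchIn-d′ : punchIn i d′ ≡ d
    punchIn-d′ = FinP.punchIn-punchOut i≢d
    off-d′ : ∀ c → c ≢ d′ → punchIn i c ≢ d
    off-d′ c c≢d′ eq = c≢d′ (FinP.punchIn-injective i c d′ (trans eq (sym punchIn-d′)))
    minor-linear : det (minor i M) ≡ a * det (minor i N) + b * det (minor i Q)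
    minor-linear = det-linear-column d′ a b
      (λ r c c≢d′ → M≡N (suc r) (punchIn i c) (off-d′ c c≢d′))
      (λ r c c≢d′ → M≡Q (suc r) (punchIn i c) (off-d′ c c≢d′))
      (λ r → subst (λ e → M (suc r) e ≡ a * N (suc r) e + b * Q (suc r) e) (sym punchIn-d′) (column (suc r)))

inject₁≢suc : ∀ {n} (j : Fin n) → inject₁ j ≢ suc j
inject₁≢suc zero    ()
inject₁≢suc (suc j) eq = inject₁≢suc j (FinP.suc-injective eq)

addNextColumn : ∀ {n} → Matrix (ℕ.suc n) → Fin n → Matrix (ℕ.suc n)
addNextColumn M j r = updateAt (M r) (inject₁ j) (λ x → x + M r (suc j))

combineColumns : ∀ {n} → Matrix (ℕ.suc n) → Fin n → ℤ → ℤ → Matrix (ℕ.suc n)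
combineColumns M j a b r = updateAt (M r) (suc j) (λ x → a * x - b * M r (inject₁ j))

det-addNextColumn : ∀ {n} (M : Matrix (ℕ.suc n)) j → det (addNextColumn M j) ≡ det M
det-addNextColumn M j = begin
  det (addNextColumn M j)     ≡⟨ det-linear-column (inject₁ j) (+ 1) (+ 1) {N = M} {Q = Q} unchanged unchanged-Q column ⟩
  + 1 * det M + + 1 * det Q   ≡⟨ cong (λ x → + 1 * det M + + 1 * x) (det-adjacent Q j Q-adjacent) ⟩
  + 1 * det M + + 1 * + 0     ≡⟨ ring (det M) ⟩
  det M                       ∎
  where
  Q : Matrix _
  Q r = updateAt (M r) (inject₁ j) (λ _ → M r (suc j))
  unchanged : ∀ r c → c ≢ inject₁ j → addNextColumn M j r c ≡ M r c
  unchanged r c c≢j = updateAt-minimal c (inject₁ j) (M r) c≢j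
  unchanged-Q : ∀ r c → c ≢ inject₁ j → addNextColumn M j r c ≡ Q r c
  unchanged-Q r c c≢j = trans (unchanged r c c≢j) (sym (updateAt-minimal c (inject₁ j) (M r) c≢j))
  column : ∀ r → addNextColumn M j r (inject₁ j) ≡ + 1 * M r (inject₁ j) + + 1 * Q r (inject₁ j)
  column r = begin
    addNextColumn M j r (inject₁ j)            ≡⟨ updateAt-updates (inject₁ j) (M r) ⟩
    M r (inject₁ j) + M r (suc j)              ≡⟨ cong₂ _+_ (ℤP.*-identityˡ (M r (inject₁ j))) (ℤP.*-identityˡ (M r (suc j))) ⟨
    + 1 * M r (inject₁ j) + + 1 * M r (suc j)  ≡⟨ cong (λ x → + 1 * M r (inject₁ j) + + 1 * x) (updateAt-updates (inject₁ j) (M r)) ⟨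
    + 1 * M r (inject₁ j) + + 1 * Q r (inject₁ j) ∎
  Q-adjacent : ∀ r → Q r (inject₁ j) ≡ Q r (suc j)
  Q-adjacent r = trans (updateAt-updates (inject₁ j) (M r))
    (sym (updateAt-minimal (suc j) (inject₁ j) (M r) (inject₁≢suc j ∘ sym)))
  ring : ∀ x → + 1 * x + + 1 * + 0 ≡ x
  ring = solve-∀

det-combineColumns : ∀ {n} (M : Matrix (ℕ.suc n)) j a b → det (combineColumns M j a b) ≡ a * det M
det-combineColumns M j a b = begin
  det (combineColumns M j a b) ≡⟨ det-linear-column (suc j) a (- b) {N = M} {Q = Q} unchanged unchanged-Q column ⟩
  a * det M + - b * det Q      ≡⟨ cong (λ x → a * det M + - b * x) (det-adjacent Q j Q-adjacent) ⟩
  a * det M + - b * + 0        ≡⟨ ring a b (det M) ⟩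
  a * det M                    ∎
  where
  Q : Matrix _
  Q r = updateAt (M r) (suc j) (λ _ → M r (inject₁ j))
  unchanged : ∀ r c → c ≢ suc j → combineColumns M j a b r c ≡ M r c
  unchanged r c c≢j+1 = updateAt-minimal c (suc j) (M r) c≢j+1
  unchanged-Q : ∀ r c → c ≢ suc j → combineColumns M j a b r c ≡ Q r c
  unchanged-Q r c c≢j+1 = trans (unchanged r c c≢j+1) (sym (updateAt-minimal c (suc j) (M r) c≢j+1))
  column : ∀ r → combineColumns M j a b r (suc j) ≡ a * M r (suc j) + - b * Q r (suc j)
  column r = begin
    combineColumns M j a b r (suc j)        ≡⟨ updateAt-updates (suc j) (M r) ⟩
    a * M r (suc j) - b * M r (inject₁ j)   ≡⟨ cong (λ x → a * M r (suc j) + x) (ℤP.neg-distribˡ-* b _) ⟩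
    a * M r (suc j) + - b * M r (inject₁ j) ≡⟨ cong (λ x → a * M r (suc j) + - b * x) (updateAt-updates (suc j) (M r)) ⟨
    a * M r (suc j) + - b * Q r (suc j)     ∎
  Q-adjacent : ∀ r → Q r (inject₁ j) ≡ Q r (suc j)
  Q-adjacent r = trans (updateAt-minimal (inject₁ j) (suc j) (M r) (inject₁≢suc j))
    (sym (updateAt-updates (suc j) (M r)))
  ring : ∀ a b x → a * x + - b * + 0 ≡ a * x
  ring = solve-∀

infixr 7 _*ᵥ_

_*ᵥ_ : ∀ {n} → Matrix n → (Fin n → ℤ) → Fin n → ℤ
(M *ᵥ v) r = sum (λ c → M r c * v c)

addNextColumn-image : ∀ {n} (M : Matrix (ℕ.suc n)) j v →
  ∃ λ v′ → ∀ r → (addNextColumn M j *ᵥ v′) r ≡ (M *ᵥ v) r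
addNextColumn-image M j v = v′ , λ r → sum-adjacent-cong j (off r) (pair r)
  where
  v′ = updateAt v (suc j) (λ x → x - v (inject₁ j))
  off : ∀ r c → c ≢ inject₁ j → c ≢ suc j → addNextColumn M j r c * v′ c ≡ M r c * v c
  off r c c≢j c≢j+1 = cong₂ _*_ (updateAt-minimal c (inject₁ j) (M r) c≢j) (updateAt-minimal c (suc j) v c≢j+1)
  pair : ∀ r → addNextColumn M j r (inject₁ j) * v′ (inject₁ j) + addNextColumn M j r (suc j) * v′ (suc j)
             ≡ M r (inject₁ j) * v (inject₁ j) + M r (suc j) * v (suc j)
  pair r = begin
    addNextColumn M j r (inject₁ j) * v′ (inject₁ j) + addNextColumn M j r (suc j) * v′ (suc j)
      ≡⟨ cong₂ (λ x y → x * v′ (inject₁ j) + y * v′ (suc j)) (updateAt-updates (inject₁ j) (M r))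
               (updateAt-minimal (suc j) (inject₁ j) (M r) (inject₁≢suc j ∘ sym)) ⟩
    (M r (inject₁ j) + M r (suc j)) * v′ (inject₁ j) + M r (suc j) * v′ (suc j)
      ≡⟨ cong₂ (λ x y → (M r (inject₁ j) + M r (suc j)) * x + M r (suc j) * y)
               (updateAt-minimal (inject₁ j) (suc j) v (inject₁≢suc j)) (updateAt-updates (suc j) v) ⟩
    (M r (inject₁ j) + M r (suc j)) * v (inject₁ j) + M r (suc j) * (v (suc j) - v (inject₁ j))
      ≡⟨ ring (M r (inject₁ j)) (M r (suc j)) (v (inject₁ j)) (v (suc j)) ⟩
    M r (inject₁ j) * v (inject₁ j) + M r (suc j) * v (suc j) ∎
    where
    ring : ∀ m₀ m₁ v₀ v₁ → (m₀ + m₁) * v₀ + m₁ * (v₁ - v₀) ≡ m₀ * v₀ + m₁ * v₁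
    ring = solve-∀

combineColumns-image : ∀ {n} (M : Matrix (ℕ.suc n)) j a b v →
  ∃ λ v′ → ∀ r → (combineColumns M j a b *ᵥ v′) r ≡ a * (M *ᵥ v) r
combineColumns-image M j a b v = v′ , λ r →
  trans (sum-adjacent-cong j (off r) (pair r)) (sym (*-distribˡ-sum a (λ c → M r c * v c)))
  where
  v″ = updateAt (λ c → a * v c) (inject₁ j) (λ _ → a * v (inject₁ j) + b * v (suc j))
  v′ = updateAt v″ (suc j) (λ _ → v (suc j))
  v′-j : v′ (inject₁ j) ≡ a * v (inject₁ j) + b * v (suc j)
  v′-j = trans (updateAt-minimal (inject₁ j) (suc j) v″ (inject₁≢suc j)) (updateAt-updates (inject₁ j) (λ c → a * v c))
  off : ∀ r c → c ≢ inject₁ j → c ≢ suc j → combineColumns M j a b r c * v′ c ≡ a * (M r c * v c)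
  off r c c≢j c≢j+1 = begin
    combineColumns M j a b r c * v′ c ≡⟨ cong₂ _*_ (updateAt-minimal c (suc j) (M r) c≢j+1)
                                                    (trans (updateAt-minimal c (suc j) v″ c≢j+1) (updateAt-minimal c (inject₁ j) (λ c → a * v c) c≢j)) ⟩
    M r c * (a * v c)                 ≡⟨ ring (M r c) a (v c) ⟩
    a * (M r c * v c)                 ∎
    where
    ring : ∀ m a x → m * (a * x) ≡ a * (m * x)
    ring = solve-∀
  pair : ∀ r → combineColumns M j a b r (inject₁ j) * v′ (inject₁ j) + combineColumns M j a b r (suc j) * v′ (suc j)
             ≡ a * (M r (inject₁ j) * v (inject₁ j)) + a * (M r (suc j) * v (suc j))
  pair r = begin
    combineColumns M j a b r (inject₁ j) * v′ (inject₁ j) + combineColumns M j a b r (suc j) * v′ (suc j)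
      ≡⟨ cong₂ (λ x y → x * v′ (inject₁ j) + y * v′ (suc j))
               (updateAt-minimal (inject₁ j) (suc j) (M r) (inject₁≢suc j)) (updateAt-updates (suc j) (M r)) ⟩
    M r (inject₁ j) * v′ (inject₁ j) + (a * M r (suc j) - b * M r (inject₁ j)) * v′ (suc j)
      ≡⟨ cong₂ (λ x y → M r (inject₁ j) * x + (a * M r (suc j) - b * M r (inject₁ j)) * y) v′-j (updateAt-updates (suc j) v″) ⟩
    M r (inject₁ j) * (a * v (inject₁ j) + b * v (suc j)) + (a * M r (suc j) - b * M r (inject₁ j)) * v (suc j)
      ≡⟨ ring a b (M r (inject₁ j)) (M r (suc j)) (v (inject₁ j)) (v (suc j)) ⟩
    a * (M r (inject₁ j) * v (inject₁ j)) + a * (M r (suc j) * v (suc j)) ∎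
    where
    ring : ∀ a b m₀ m₁ v₀ v₁ → m₀ * (a * v₀ + b * v₁) + (a * m₁ - b * m₀) * v₁ ≡ a * (m₀ * v₀) + a * (m₁ * v₁)
    ring = solve-∀

module _ (p : ℕ) (p-prime : Prime p) where

  ∣-euclid : ∀ a b → + p ∣ a * b → + p ∣ a ⊎ + p ∣ b
  ∣-euclid a b p∣ab with euclidsLemma ℤ.∣ a ∣ ℤ.∣ b ∣ p-prime (subst (p ℕDiv.∣_) (ℤP.abs-* a b) (∣⇒∣ᵤ p∣ab))
  ... | inj₁ p∣a = inj₁ (∣ᵤ⇒∣ p∣a)
  ... | inj₂ p∣b = inj₂ (∣ᵤ⇒∣ p∣b)

  ∤1 : ¬ + p ∣ + 1
  ∤1 p∣1 = ¬prime[1] (subst Prime (ℕDiv.∣1⇒≡1 (∣⇒∣ᵤ p∣1)) p-prime)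

  ∣-sum : ∀ {n} (f : Fin n → ℤ) → (∀ i → + p ∣ f i) → + p ∣ sum f
  ∣-sum {ℕ.zero}  f p∣f = divides (+ 0) refl
  ∣-sum {ℕ.suc n} f p∣f = ∣m∣n⇒∣m+n (p∣f zero) (∣-sum (f ∘ suc) (p∣f ∘ suc))

  ∣-altSum : ∀ {n} (f : Fin n → ℤ) → (∀ i → + p ∣ f i) → + p ∣ altSum f
  ∣-altSum {ℕ.zero}  f p∣f = divides (+ 0) refl
  ∣-altSum {ℕ.suc n} f p∣f = ∣m∣n⇒∣m-n (p∣f zero) (∣-altSum (f ∘ suc) (p∣f ∘ suc))

  -- Targets are only hit up to a unit factor l, since combineColumns scales the image by a.
  SurjectiveMod : ∀ {n} → Matrix n → Set
  SurjectiveMod {n} M = ∀ (t : Fin n → ℤ) →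
    ∃₂ λ (v : Fin n → ℤ) (l : ℤ) → ¬ + p ∣ l × (∀ r → + p ∣ (M *ᵥ v) r - l * t r)

  record Reduces {n} (M M′ : Matrix n) : Set where
    constructor mkReduces
    field
      surjectivity : SurjectiveMod M → SurjectiveMod M′
      det-divisibility : + p ∣ det M → + p ∣ det M′

  reduces-refl : ∀ {n} {M : Matrix n} → Reduces M M
  reduces-refl = mkReduces (λ onto → onto) (λ p∣det → p∣det)

  reduces-trans : ∀ {n} {M₁ M₂ M₃ : Matrix n} → Reduces M₁ M₂ → Reduces M₂ M₃ → Reduces M₁ M₃
  reduces-trans (mkReduces onto₁₂ det₁₂) (mkReduces onto₂₃ det₂₃) = mkReduces (onto₂₃ ∘ onto₁₂) (det₂₃ ∘ det₁₂)

  addNextColumn-reduces : ∀ {n} (M : Matrix (ℕ.suc n)) j → Reduces M (addNextColumn M j)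
  addNextColumn-reduces M j = mkReduces onto (subst (+ p ∣_) (sym (det-addNextColumn M j)))
    where
    onto : SurjectiveMod M → SurjectiveMod (addNextColumn M j)
    onto surj t with surj t
    ... | v , l , p∤l , hits with addNextColumn-image M j v
    ...   | v′ , same = v′ , l , p∤l , λ r → subst (λ x → + p ∣ x - l * t r) (sym (same r)) (hits r)

  combineColumns-reduces : ∀ {n} (M : Matrix (ℕ.suc n)) j a b → ¬ + p ∣ a → Reduces M (combineColumns M j a b)
  combineColumns-reduces M j a b p∤a =
    mkReduces onto λ p∣det → subst (+ p ∣_) (sym (det-combineColumns M j a b)) (∣n⇒∣m*n a p∣det)
    where
    onto : SurjectiveMod M → SurjectiveMod (combineColumns M j a b)
    onto surj t with surj t
    ... | v , l , p∤l , hits with combineColumns-image M j a b v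
    ...   | v′ , scaled = v′ , a * l , p∤al , λ r → subst (+ p ∣_) (eq r) (∣n⇒∣m*n a (hits r))
      where
      p∤al : ¬ + p ∣ a * l
      p∤al p∣al with ∣-euclid a l p∣al
      ... | inj₁ p∣a = p∤a p∣a
      ... | inj₂ p∣l = p∤l p∣l
      ring : ∀ a x l t → a * (x - l * t) ≡ a * x - a * l * t
      ring = solve-∀
      eq : ∀ r → a * ((M *ᵥ v) r - l * t r) ≡ (combineColumns M j a b *ᵥ v′) r - a * l * t r
      eq r = trans (ring a ((M *ᵥ v) r) l (t r)) (cong (λ x → x - a * l * t r) (sym (scaled r)))

  TopRowVanishesAfter : ∀ {n} → ℕ → Matrix (ℕ.suc n) → Set
  TopRowVanishesAfter k M = ∀ c → k < toℕ c → + p ∣ M zero c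

  ReducesToVanishingAfter : ∀ {n} → ℕ → Matrix (ℕ.suc n) → Set
  ReducesToVanishingAfter k M = ∃ λ M′ → Reduces M M′ × TopRowVanishesAfter k M′

  reduce-further : ∀ {n} {M M₁ : Matrix (ℕ.suc n)} {k} →
    Reduces M M₁ → ReducesToVanishingAfter k M₁ → ReducesToVanishingAfter k M
  reduce-further reduces₁ (M₂ , reduces₂ , vanishing₂) = M₂ , reduces-trans reduces₁ reduces₂ , vanishing₂

  clear-next-entry : ∀ {n} (M : Matrix (ℕ.suc n)) j → ¬ + p ∣ M zero (inject₁ j) →
    TopRowVanishesAfter (ℕ.suc (toℕ j)) M → ReducesToVanishingAfter (toℕ j) M
  clear-next-entry M j p∤a vanishing =
    combineColumns M j a b , combineColumns-reduces M j a b p∤a , vanishing′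
    where
    a = M zero (inject₁ j)
    b = M zero (suc j)
    ring : ∀ a b → a * b - b * a ≡ + 0
    ring = solve-∀
    vanishing′ : TopRowVanishesAfter (toℕ j) (combineColumns M j a b)
    vanishing′ c j<c with c ≟ suc j
    ... | yes refl = subst (+ p ∣_) (sym (trans (updateAt-updates (suc j) (M zero)) (ring a b))) (divides (+ 0) refl)
    ... | no c≢j+1 = subst (+ p ∣_) (sym (updateAt-minimal c (suc j) (M zero) c≢j+1))
                           (vanishing c (ℕP.≤∧≢⇒< j<c (c≢j+1 ∘ FinP.toℕ-injective ∘ sym)))

  sweep-step : ∀ {n} (M : Matrix (ℕ.suc n)) j →
    TopRowVanishesAfter (ℕ.suc (toℕ j)) M → ReducesToVanishingAfter (toℕ j) M
  sweep-step M j vanishing with + p ∣? M zero (suc j)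
  ... | yes p∣b = M , reduces-refl , vanishing′
    where
    vanishing′ : TopRowVanishesAfter (toℕ j) M
    vanishing′ c j<c with c ≟ suc j
    ... | yes refl  = p∣b
    ... | no c≢j+1 = vanishing c (ℕP.≤∧≢⇒< j<c (c≢j+1 ∘ FinP.toℕ-injective ∘ sym))
  ... | no p∤b with + p ∣? M zero (inject₁ j)
  ...   | no p∤a = clear-next-entry M j p∤a vanishing
  ...   | yes p∣a =
    reduce-further (addNextColumn-reduces M j) (clear-next-entry (addNextColumn M j) j p∤a′ vanishing′)
    where
    p∤a′ : ¬ + p ∣ addNextColumn M j zero (inject₁ j)
    p∤a′ p∣a+b = p∤b (∣m+n∣m⇒∣n (subst (+ p ∣_) (updateAt-updates (inject₁ j) (M zero)) p∣a+b) p∣a)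
    vanishing′ : TopRowVanishesAfter (ℕ.suc (toℕ j)) (addNextColumn M j)
    vanishing′ c j+1<c = subst (+ p ∣_) (sym (updateAt-minimal c (inject₁ j) (M zero) c≢j)) (vanishing c j+1<c)
      where
      c≢j : c ≢ inject₁ j
      c≢j refl = ℕP.<-irrefl refl
        (ℕP.<-trans (ℕP.n<1+n (toℕ j)) (subst (ℕ.suc (toℕ j) <_) (FinP.toℕ-inject₁ j) j+1<c))

  sweep : ∀ {n} k → k ≤ n → (M : Matrix (ℕ.suc n)) → TopRowVanishesAfter k M → ReducesToVanishingAfter 0 M
  sweep ℕ.zero    _   M vanishing = M , reduces-refl , vanishing
  sweep (ℕ.suc k) k<n M vanishing =
    continue (sweep-step M j (subst (λ i → TopRowVanishesAfter (ℕ.suc i) M) (sym toℕ-j) vanishing))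
    where
    j = fromℕ< k<n
    toℕ-j : toℕ j ≡ k
    toℕ-j = FinP.toℕ-fromℕ< k<n
    continue : ReducesToVanishingAfter (toℕ j) M → ReducesToVanishingAfter 0 M
    continue (M₁ , reduces₁ , vanishing₁) =
      reduce-further reduces₁ (sweep k (ℕP.<⇒≤ k<n) M₁ (subst (λ i → TopRowVanishesAfter i M₁) toℕ-j vanishing₁))

  module _ {n} (M : Matrix (ℕ.suc n)) (top-row : ∀ c → + p ∣ M zero (suc c)) where

    private
      top-row-rest : ∀ (v : Fin (ℕ.suc n) → ℤ) → + p ∣ sum (λ c → M zero (suc c) * v (suc c))
      top-row-rest v = ∣-sum (λ c → M zero (suc c) * v (suc c)) λ c → ∣m⇒∣m*n (v (suc c)) (top-row c)

    corner-indivisible : SurjectiveMod M → ¬ + p ∣ M zero zero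
    corner-indivisible onto p∣corner with onto (+ 1 ∷ᵥ λ _ → + 0)
    ... | v , l , p∤l , hits = p∤l (subst (+ p ∣_) (ring (M zero zero * v zero) _ l) p∣l)
      where
      p∣l : + p ∣ (M *ᵥ v) zero - ((M *ᵥ v) zero - l * + 1)
      p∣l = ∣m∣n⇒∣m-n (∣m∣n⇒∣m+n (∣m⇒∣m*n (v zero) p∣corner) (top-row-rest v)) (hits zero)
      ring : ∀ x y l → x + y - (x + y - l * + 1) ≡ l
      ring = solve-∀

    minor-surjective : SurjectiveMod M → SurjectiveMod (minor zero M)
    minor-surjective onto t with onto (+ 0 ∷ᵥ t)
    ... | v , l , p∤l , hits = v ∘ suc , l , p∤l , λ r →
      subst (+ p ∣_) (ring (M (suc r) zero * v zero) _ (l * t r))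
            (∣m∣n⇒∣m-n (hits (suc r)) (∣n⇒∣m*n (M (suc r) zero) p∣v₀))
      where
      ring : ∀ x y z → x + y - z - x ≡ y - z
      ring = solve-∀
      ring₀ : ∀ x y l → x + y - l * + 0 - y ≡ x
      ring₀ = solve-∀
      p∣v₀ : + p ∣ v zero
      p∣v₀ with ∣-euclid (M zero zero) (v zero)
                 (subst (+ p ∣_) (ring₀ (M zero zero * v zero) _ l) (∣m∣n⇒∣m-n (hits zero) (top-row-rest v)))
      ... | inj₁ p∣corner = contradiction p∣corner (corner-indivisible onto)
      ... | inj₂ p∣v₀′    = p∣v₀′

    det-corner : + p ∣ det M → + p ∣ M zero zero * det (minor zero M)
    det-corner p∣det = subst (+ p ∣_) (ring (M zero zero * det (minor zero M)) _) (∣m∣n⇒∣m+n p∣det p∣rest)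
      where
      p∣rest : + p ∣ altSum (λ i → M zero (suc i) * det (minor (suc i) M))
      p∣rest = ∣-altSum (λ i → M zero (suc i) * det (minor (suc i) M))
                        λ i → ∣m⇒∣m*n (det (minor (suc i) M)) (top-row i)
      ring : ∀ x y → x - y + y ≡ x
      ring = solve-∀

    reduced-det-indivisible : (∀ (N : Matrix n) → SurjectiveMod N → ¬ + p ∣ det N) →
      SurjectiveMod M → ¬ + p ∣ det M
    reduced-det-indivisible minor-indivisible onto p∣det
      with ∣-euclid (M zero zero) (det (minor zero M)) (det-corner p∣det)
    ... | inj₁ p∣corner = corner-indivisible onto p∣corner
    ... | inj₂ p∣minor  = minor-indivisible (minor zero M) (minor-surjective onto) p∣minor

  surjective⇒det-indivisible : ∀ {n} (M : Matrix n) → SurjectiveMod M → ¬ + p ∣ det M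
  surjective⇒det-indivisible {ℕ.zero}  M onto = ∤1
  surjective⇒det-indivisible {ℕ.suc n} M onto
    with sweep n ℕP.≤-refl M (λ c n<c → contradiction (FinP.toℕ<n c) (ℕP.<⇒≱ (ℕ.s≤s n<c)))
  ... | M′ , mkReduces onto⇒ det⇒ , vanishing =
    reduced-det-indivisible M′ (λ c → vanishing (suc c) (ℕ.s≤s ℕ.z≤n)) surjective⇒det-indivisible (onto⇒ onto)
    ∘ det⇒

prime-divisor : ∀ n → .{{ℕ.NonTrivial n}} → ∃ λ p → Prime p × p ℕDiv.∣ n
prime-divisor n with factorise n {{ℕ.nonTrivial⇒nonZero n}}
... | record { factors = [] ; isFactorisation = n≡1 } = contradiction n≡1 ℕ.nonTrivial⇒≢1
... | record { factors = q ∷ qs ; isFactorisation = n≡q*qs ; factorsPrime = q-prime ∷ _ } =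
  q , q-prime , subst (q ℕDiv.∣_) (sym n≡q*qs) (ℕDiv.m∣m*n (product qs))

nonunit-prime-divisor : ∀ d → d ≢ + 1 → d ≢ - + 1 → ∃ λ p → Prime p × + p ∣ d
nonunit-prime-divisor (+ 0)               _   _    = 2 , prime[2] , divides (+ 0) refl
nonunit-prime-divisor (+ 1)               d≢1 _    = contradiction refl d≢1
nonunit-prime-divisor (+ ℕ.suc (ℕ.suc m)) _   _    with prime-divisor (ℕ.suc (ℕ.suc m))
... | p , p-prime , p∣d = p , p-prime , ∣ᵤ⇒∣ p∣d
nonunit-prime-divisor ℤ.-[1+ 0 ]          _   d≢-1 = contradiction refl d≢-1
nonunit-prime-divisor ℤ.-[1+ ℕ.suc m ]    _   _    with prime-divisor (ℕ.suc (ℕ.suc m))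
... | p , p-prime , p∣d = p , p-prime , ∣ᵤ⇒∣ p∣d

m%n≡o%n⇒n∣m-o : ∀ n .{{_ : ℕ.NonZero n}} x y → x ℕ.% n ≡ y ℕ.% n → + n ∣ + x - + y
m%n≡o%n⇒n∣m-o n x y x%n≡y%n = divides (+ (x ℕ./ n) - + (y ℕ./ n)) (begin
  + x - + y                                                      ≡⟨ cong₂ _-_ (split x) (split y) ⟩
  + (x ℕ.% n) + + (x ℕ./ n) * + n - (+ (y ℕ.% n) + + (y ℕ./ n) * + n)
    ≡⟨ cong (λ r → r + + (x ℕ./ n) * + n - (+ (y ℕ.% n) + + (y ℕ./ n) * + n)) (cong +_ x%n≡y%n) ⟩
  + (y ℕ.% n) + + (x ℕ./ n) * + n - (+ (y ℕ.% n) + + (y ℕ./ n) * + n)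
    ≡⟨ ring (+ (y ℕ.% n)) (+ (x ℕ./ n)) (+ (y ℕ./ n)) (+ n) ⟩
  (+ (x ℕ./ n) - + (y ℕ./ n)) * + n                             ∎)
  where
  split : ∀ z → + z ≡ + (z ℕ.% n) + + (z ℕ./ n) * + n
  split z = trans (cong +_ (ℕDivMod.m≡m%n+[m/n]*n z n))
                  (trans (ℤP.pos-+ (z ℕ.% n) _) (cong (λ q → + (z ℕ.% n) + q) (ℤP.pos-* (z ℕ./ n) n)))
  ring : ∀ r a b n → r + a * n - (r + b * n) ≡ (a - b) * n
  ring = solve-∀

n∣i%ℕn-i : ∀ n .{{_ : ℕ.NonZero n}} z → + n ∣ + (z ℤ.%ℕ n) - z
n∣i%ℕn-i n z = divides (- (z ℤ./ℕ n)) (begin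
  + (z ℤ.%ℕ n) - z                                  ≡⟨ cong (λ y → + (z ℤ.%ℕ n) - y) (ℤDivMod.a≡a%ℕn+[a/ℕn]*n z n) ⟩
  + (z ℤ.%ℕ n) - (+ (z ℤ.%ℕ n) + (z ℤ./ℕ n) * + n)  ≡⟨ ring (+ (z ℤ.%ℕ n)) (z ℤ./ℕ n) (+ n) ⟩
  - (z ℤ./ℕ n) * + n                                ∎)
  where
  ring : ∀ r q n → r - (r + q * n) ≡ - q * n
  ring = solve-∀

parikhPrefix-+ : ∀ {σ} (w : Word∞ σ) m n j →
  parikhPrefix w (m ℕ.+ n) j ≡ parikhPrefix w m j ℕ.+ parikhPrefix (λ i → w (m ℕ.+ i)) n j
parikhPrefix-+ w m ℕ.zero j = begin
  parikhPrefix w (m ℕ.+ 0) j ≡⟨ cong (λ k → parikhPrefix w k j) (ℕP.+-identityʳ m) ⟩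
  parikhPrefix w m j         ≡⟨ ℕP.+-identityʳ _ ⟨
  parikhPrefix w m j ℕ.+ 0   ∎
parikhPrefix-+ w m (ℕ.suc n) j = begin
  parikhPrefix w (m ℕ.+ ℕ.suc n) j
    ≡⟨ cong (λ k → parikhPrefix w k j) (ℕP.+-suc m n) ⟩
  parikhPrefix w (m ℕ.+ n) j ℕ.+ indicator (w (m ℕ.+ n)) j
    ≡⟨ cong (ℕ._+ indicator (w (m ℕ.+ n)) j) (parikhPrefix-+ w m n j) ⟩
  parikhPrefix w m j ℕ.+ parikhPrefix (λ i → w (m ℕ.+ i)) n j ℕ.+ indicator (w (m ℕ.+ n)) j
    ≡⟨ ℕP.+-assoc (parikhPrefix w m j) _ _ ⟩
  parikhPrefix w m j ℕ.+ parikhPrefix (λ i → w (m ℕ.+ i)) (ℕ.suc n) j ∎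

parikhPrefix-cong : ∀ {σ} {w w′ : Word∞ σ} n → (∀ i → i < n → w i ≡ w′ i) → ∀ j →
  parikhPrefix w n j ≡ parikhPrefix w′ n j
parikhPrefix-cong ℕ.zero    w≡w′ j = refl
parikhPrefix-cong (ℕ.suc n) w≡w′ j =
  cong₂ (λ k x → k ℕ.+ indicator x j) (parikhPrefix-cong n (λ i i<n → w≡w′ i (ℕP.m<n⇒m<1+n i<n)) j)
                                      (w≡w′ n (ℕP.n<1+n n))

length-filter-∷ : ∀ {σ} (j x : Fin σ) xs →
  length (filter (_≟ j) (x ∷ xs)) ≡ indicator x j ℕ.+ length (filter (_≟ j) xs)
length-filter-∷ j x xs with does (x ≟ j)
... | true  = refl
... | false = refl

parikhPrefix-occurrence : ∀ {σ} (w : Word∞ σ) (u : List (Fin σ)) → OccursAt w u 0 → ∀ j →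
  parikhPrefix w (length u) j ≡ length (filter (_≟ j) u)
parikhPrefix-occurrence w []       occ j = refl
parikhPrefix-occurrence w (x ∷ xs) occ j = begin
  parikhPrefix w (1 ℕ.+ length xs) j
    ≡⟨ parikhPrefix-+ w 1 (length xs) j ⟩
  indicator (w 0) j ℕ.+ parikhPrefix (w ∘ ℕ.suc) (length xs) j
    ≡⟨ cong₂ (λ y n → indicator y j ℕ.+ n) (occ zero) (parikhPrefix-occurrence (w ∘ ℕ.suc) xs (occ ∘ suc) j) ⟩
  indicator x j ℕ.+ length (filter (_≟ j) xs)
    ≡⟨ length-filter-∷ j x xs ⟨
  length (filter (_≟ j) (x ∷ xs)) ∎

parikhVector : ∀ {σ} → Word∞ σ → ℕ → Fin σ → ℤ
parikhVector w n j = + parikhPrefix w n j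

parikhVector-cutPt : ∀ {σ} {φ : Morphism σ} {w : Word∞ σ} → IsFixedPoint φ w → ∀ i →
  parikhVector w (cutPt φ w i) ≗ incMatrix φ *ᵥ parikhVector w i
parikhVector-cutPt {φ = φ} fixed ℕ.zero j = sym (sum-zero λ c → ℤP.*-zeroʳ (incMatrix φ j c))
parikhVector-cutPt {φ = φ} {w} fixed (ℕ.suc i) j = begin
  parikhVector w (cutPt φ w (ℕ.suc i)) j
    ≡⟨ cong (λ n → + n) (parikhPrefix-+ w (cutPt φ w i) _ j) ⟩
  (+ (parikhPrefix w (cutPt φ w i) j ℕ.+ parikhPrefix (λ k → w (cutPt φ w i ℕ.+ k)) (length (φ (w i))) j))
    ≡⟨ cong (λ n → + (parikhPrefix w (cutPt φ w i) j ℕ.+ n)) (parikhPrefix-occurrence _ (φ (w i)) (fixed i) j) ⟩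
  (+ (parikhPrefix w (cutPt φ w i) j ℕ.+ length (filter (_≟ j) (φ (w i)))))
    ≡⟨ ℤP.pos-+ (parikhPrefix w (cutPt φ w i) j) _ ⟩
  parikhVector w (cutPt φ w i) j + A j (w i)
    ≡⟨ cong₂ _+_ (parikhVector-cutPt fixed i j) (sym (sum-indicator (A j) (w i))) ⟩
  (A *ᵥ parikhVector w i) j + sum (λ c → A j c * + indicator (w i) c)
    ≡⟨ ∑-distrib-+ (λ c → A j c * parikhVector w i c) (λ c → A j c * + indicator (w i) c) ⟨
  sum (λ c → A j c * parikhVector w i c + A j c * + indicator (w i) c)
    ≡⟨ sum-cong-≗ (λ c → trans (sym (ℤP.*-distribˡ-+ (A j c) _ _))
                                (cong (A j c *_) (sym (ℤP.pos-+ (parikhPrefix w i c) (indicator (w i) c))))) ⟩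
  (A *ᵥ parikhVector w (ℕ.suc i)) j ∎
  where
  A = incMatrix φ

slice : ∀ {σ} → Word∞ σ → ℕ → ℕ → List (Fin σ)
slice w s L = applyUpTo (λ i → w (s ℕ.+ i)) L

slice-occurs : ∀ {σ} (w : Word∞ σ) s L → OccursAt w (slice w s L) s
slice-occurs w s L k = sym (lookup-applyUpTo (λ i → w (s ℕ.+ i)) L k)

occurs-slice : ∀ {σ} (w : Word∞ σ) s L {q} → OccursAt w (slice w s L) q →
  ∀ i → i < L → w (q ℕ.+ i) ≡ w (s ℕ.+ i)
occurs-slice w s L {q} occ i i<L = begin
  w (q ℕ.+ i)            ≡⟨ cong (λ m → w (q ℕ.+ m)) toℕ-k ⟨
  w (q ℕ.+ toℕ k)        ≡⟨ occ k ⟩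
  lookup (slice w s L) k ≡⟨ lookup-applyUpTo (λ m → w (s ℕ.+ m)) L k ⟩
  w (s ℕ.+ toℕ k)        ≡⟨ cong (λ m → w (s ℕ.+ m)) toℕ-k ⟩
  w (s ℕ.+ i)            ∎
  where
  i<length : i < length (slice w s L)
  i<length = subst (i <_) (sym (length-applyUpTo (λ m → w (s ℕ.+ m)) L)) i<L
  k : Fin (length (slice w s L))
  k = fromℕ< i<length
  toℕ-k : toℕ k ≡ i
  toℕ-k = FinP.toℕ-fromℕ< i<length

OccurrencesAlignWithCuts : ∀ {σ} → Morphism σ → Word∞ σ → List (Fin σ) → (Fin σ → ℕ) → Set
OccurrencesAlignWithCuts φ w v c = ∀ q → OccursAt w v q →
  ∃ λ i → ∀ j → parikhPrefix w q j ℕ.+ c j ≡ parikhPrefix w (cutPt φ w i) j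

m-[1+d]≡n⇒m≡n+[1+d] : ∀ {m d n} → + m + ℤ.-[1+ d ] ≡ + n → m ≡ n ℕ.+ ℕ.suc d
m-[1+d]≡n⇒m≡n+[1+d] {m} {d} {n} eq = ℤP.+-injective (begin
  + m                          ≡⟨ ring (+ m) (+ ℕ.suc d) ⟩
  + m + ℤ.-[1+ d ] + + ℕ.suc d ≡⟨ cong (_+ + ℕ.suc d) eq ⟩
  + n + + ℕ.suc d              ≡⟨ ℤP.pos-+ n (ℕ.suc d) ⟨
  + (n ℕ.+ ℕ.suc d)            ∎)
  where
  ring : ∀ x y → x ≡ x + - y + y
  ring = solve-∀

-- For a shift k ≥ 0 extend u to the right by k letters, which c then counts; for k < 0 extend u
-- to the left, back to the cutting point in front of one fixed occurrence, and take c = 0.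
cutting⇒aligned-factor : ∀ {σ} {φ : Morphism σ} {w : Word∞ σ} {u} → IsFactor w u → IsCutting φ w u →
  ∃₂ λ v c → IsFactor w v × OccurrencesAlignWithCuts φ w v c
cutting⇒aligned-factor {u = []} (u≢[] , _) _ = contradiction refl u≢[]
cutting⇒aligned-factor {φ = φ} {w} {u@(_ ∷ _)} (_ , m₀ , occ₀) (+ k , cut) =
  slice w m₀ L , c , ((λ ()) , m₀ , slice-occurs w m₀ L) , aligned
  where
  L = length u ℕ.+ k
  c = parikhPrefix (λ i → w (m₀ ℕ.+ i)) k
  u-occurs : ∀ {q} → OccursAt w (slice w m₀ L) q → OccursAt w u q
  u-occurs occ t = trans (occurs-slice w m₀ L occ (toℕ t) (ℕP.≤-trans (FinP.toℕ<n t) (ℕP.m≤m+n _ k))) (occ₀ t)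
  aligned : OccurrencesAlignWithCuts φ w (slice w m₀ L) c
  aligned q occ with cut q (u-occurs occ)
  ... | n , (i , cutPt≡n) , q+k≡n = i , λ j → begin
    parikhPrefix w q j ℕ.+ c j
      ≡⟨ cong (parikhPrefix w q j ℕ.+_)
              (parikhPrefix-cong k (λ l l<k → occurs-slice w m₀ L occ l (ℕP.<-≤-trans l<k (ℕP.m≤n+m k _))) j) ⟨
    parikhPrefix w q j ℕ.+ parikhPrefix (λ l → w (q ℕ.+ l)) k j
      ≡⟨ parikhPrefix-+ w q k j ⟨
    parikhPrefix w (q ℕ.+ k) j
      ≡⟨ cong (λ m → parikhPrefix w m j) (trans (ℤP.+-injective q+k≡n) (sym cutPt≡n)) ⟩
    parikhPrefix w (cutPt φ w i) j ∎
cutting⇒aligned-factor {φ = φ} {w} {u@(_ ∷ _)} (_ , m₀ , occ₀) (ℤ.-[1+ d ] , cut) with cut m₀ occ₀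
... | n₀ , _ , m₀-d≡n₀ = slice w n₀ L , (λ _ → 0) , ((λ ()) , n₀ , slice-occurs w n₀ L) , aligned
  where
  L = ℕ.suc d ℕ.+ length u
  u-occurs : ∀ {q} → OccursAt w (slice w n₀ L) q → OccursAt w u (q ℕ.+ ℕ.suc d)
  u-occurs {q} occ t = begin
    w (q ℕ.+ ℕ.suc d ℕ.+ toℕ t)   ≡⟨ cong w (ℕP.+-assoc q _ _) ⟩
    w (q ℕ.+ (ℕ.suc d ℕ.+ toℕ t)) ≡⟨ occurs-slice w n₀ L occ _ (ℕP.+-monoʳ-< (ℕ.suc d) (FinP.toℕ<n t)) ⟩
    w (n₀ ℕ.+ (ℕ.suc d ℕ.+ toℕ t)) ≡⟨ cong w (ℕP.+-assoc n₀ _ _) ⟨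
    w (n₀ ℕ.+ ℕ.suc d ℕ.+ toℕ t)  ≡⟨ cong (λ m → w (m ℕ.+ toℕ t)) (m-[1+d]≡n⇒m≡n+[1+d] m₀-d≡n₀) ⟨
    w (m₀ ℕ.+ toℕ t)              ≡⟨ occ₀ t ⟩
    lookup u t                    ∎
  aligned : OccurrencesAlignWithCuts φ w (slice w n₀ L) (λ _ → 0)
  aligned q occ with cut (q ℕ.+ ℕ.suc d) (u-occurs occ)
  ... | n , (i , cutPt≡n) , q-d≡n = i , λ j → trans (ℕP.+-identityʳ _)
    (cong (λ m → parikhPrefix w m j) (trans (ℕP.+-cancelʳ-≡ _ q n (m-[1+d]≡n⇒m≡n+[1+d] q-d≡n)) (sym cutPt≡n)))

welldoc⇒surjective : ∀ {σ} {φ : Morphism σ} {w : Word∞ σ} {v c} → IsFixedPoint φ w → IsFactor w v →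
  OccurrencesAlignWithCuts φ w v c → WELLDOC w → ∀ p (p-prime : Prime p) → SurjectiveMod p p-prime (incMatrix φ)
welldoc⇒surjective _ _ _ _ ℕ.zero p-prime = contradiction p-prime ¬prime[0]
welldoc⇒surjective {φ = φ} {w} {v} {c} fixed v-factor aligned welldoc p@(ℕ.suc m) p-prime t
  with welldoc v v-factor m (λ j → (t j - + c j) ℤ.%ℕ p)
... | q , occ , residues with aligned q occ
...   | i , parikh≡ = parikhVector w i , + 1 , ∤1 p p-prime , λ j →
  subst (+ p ∣_) (eq j) (∣m∣n⇒∣m+n (m%n≡o%n⇒n∣m-o p (parikhPrefix w q j) (target j) (residues j))
                                   (n∣i%ℕn-i p (t j - + c j)))
  where
  target : Fin _ → ℕ
  target j = (t j - + c j) ℤ.%ℕ p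
  eq : ∀ j → + parikhPrefix w q j - + target j + (+ target j - (t j - + c j))
           ≡ (incMatrix φ *ᵥ parikhVector w i) j - + 1 * t j
  eq j = begin
    + parikhPrefix w q j - + target j + (+ target j - (t j - + c j))
      ≡⟨ ring (+ parikhPrefix w q j) (+ c j) (t j) (+ target j) ⟩
    + parikhPrefix w q j + + c j - + 1 * t j
      ≡⟨ cong (λ x → x - + 1 * t j) (trans (sym (ℤP.pos-+ (parikhPrefix w q j) (c j))) (cong (λ n → + n) (parikh≡ j))) ⟩
    parikhVector w (cutPt φ w i) j - + 1 * t j
      ≡⟨ cong (λ x → x - + 1 * t j) (parikhVector-cutPt fixed i j) ⟩
    (incMatrix φ *ᵥ parikhVector w i) j - + 1 * t j ∎
    where
    ring : ∀ x c t r → x - r + (r - (t - c)) ≡ x + c - + 1 * t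
    ring = solve-∀

theorem7 : ∀ {σ} (φ : Morphism σ) (w : Word∞ σ) → GeneratedBy φ w →
    ¬ (det (incMatrix φ) ≡ + 1) → ¬ (det (incMatrix φ) ≡ - (+ 1)) →
    (∃ λ (u : List (Fin σ)) → IsFactor w u × IsCutting φ w u) →
    ¬ WELLDOC w
theorem7 φ w (_ , _ , _ , _ , _ , _ , fixed) det≢1 det≢-1 (u , u-factor , u-cutting) welldoc
  with nonunit-prime-divisor (det (incMatrix φ)) det≢1 det≢-1 | cutting⇒aligned-factor u-factor u-cutting
... | p , p-prime , p∣det | v , c , v-factor , aligned =
  surjective⇒det-indivisible p p-prime (incMatrix φ) (welldoc⇒surjective fixed v-factor aligned welldoc p p-prime) p∣det
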